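{- Let $G=(V,E)$ be a finite loopless undirected graph (parallel edges allowed), let $p\in(0,1]$ and let $s,t\in V$. Then the $s$-$t$ first arrival time $Z_{st}$ and the $t$-$s$ first arrival time $Z_{ts}$ of the spread process on $G$ with infection probability $p$ have the same distribution.
   Context: Spread process: at time $0$ the vertex set $X_0=A$ is labelled. In each discrete time step, independently for every edge having exactly one labelled endpoint, the label is copied along that edge to the unlabelled endpoint with probability $p$; all copies in one time step happen simultaneously, and labelled vertices stay labelled. $X_k$ denotes the labelled set at time $k$. For $A,B\subseteq V$, $Z_{AB}=\min\{k\ge 0: B\subseteq X_k\}$ when $X_0=A$; $Z_{st}:=Z_{\{s\}\{t\}}$.
   Formalization: The infection probability p is rational, ranging over ℚ ∩ (0,1] rather than the whole interval (0,1]. -}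

module Defs where

open import Data.Nat using (ℕ; zero; suc)
open import Data.Bool using (Bool; true; false; _∧_; _∨_; not; if_then_else_)
open import Data.Fin using (Fin)
open import Data.Fin.Properties using (_≟_)
open import Data.Product using (_×_; _,_; proj₁; proj₂)
open import Data.Vec using (Vec; []; _∷_; lookup; tabulate)
open import Data.List using (List; []; _∷_; map; _++_; foldr)
open import Data.Rational using (ℚ; 0ℚ; 1ℚ; _+_; _*_; _-_)
open import Relation.Nullary.Decidable using (⌊_⌋)
open import Relation.Binary.PropositionalEquality using (_≢_)

-- A finite loopless multigraph on vertex set Fin n with m edges,
-- given as a vector of endpoint pairs (parallel edges = repeated pairs).
record Graph : Set where
  constructor graph
  field
    n     : ℕ
    m     : ℕ
    edges : Vec (Fin n × Fin n) m

open Graph public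

Loopless : Graph → Set
Loopless G = ∀ i → proj₁ (lookup (edges G) i) ≢ proj₂ (lookup (edges G) i)

Labelled : ℕ → Set
Labelled n = Vec Bool n

allCoins : (m : ℕ) → List (Vec Bool m)
allCoins zero = [] ∷ []
allCoins (suc m) = map (true ∷_) (allCoins m) ++ map (false ∷_) (allCoins m)

weight : ∀ {m} → ℚ → Vec Bool m → ℚ
weight p [] = 1ℚ
weight p (true ∷ c) = p * weight p c
weight p (false ∷ c) = (1ℚ - p) * weight p c

copies : ∀ {n} → Labelled n → Fin n → (Fin n × Fin n) → Bool → Bool
copies X v (a , b) c =
  c ∧ ((⌊ v ≟ b ⌋ ∧ lookup X a ∧ not (lookup X b))
       ∨ (⌊ v ≟ a ⌋ ∧ lookup X b ∧ not (lookup X a)))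

anyCopy : ∀ {n k} → Labelled n → Fin n → Vec (Fin n × Fin n) k → Vec Bool k → Bool
anyCopy X v [] [] = false
anyCopy X v (e ∷ es) (c ∷ cs) = copies X v e c ∨ anyCopy X v es cs

-- one synchronous step of the spread process, given the coin outcome for
-- every edge (coins of edges without exactly one labelled endpoint are ignored)
step : (G : Graph) → Labelled (n G) → Vec Bool (m G) → Labelled (n G)
step G X c = tabulate (λ v → lookup X v ∨ anyCopy X v (edges G) c)

-- P(Z = k | X_0 = X) where Z = min{k : t ∈ X_k}, defined by first-step analysis
-- of the Markov chain (X_k).
probFirst : (G : Graph) → ℚ → Fin (n G) → ℕ → Labelled (n G) → ℚ
probFirst G p t zero X = if lookup X t then 1ℚ else 0ℚ
probFirst G p t (suc k) X =
  if lookup X t then 0ℚ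
  else foldr (λ c acc → weight p c * probFirst G p t k (step G X c) + acc) 0ℚ (allCoins (m G))

singleton : ∀ {n} → Fin n → Labelled n
singleton s = tabulate (λ v → ⌊ v ≟ s ⌋)

probZ : (G : Graph) → ℚ → Fin (n G) → Fin (n G) → ℕ → ℚ
probZ G p s t k = probFirst G p t k (singleton s)

{-# OPTIONS --safe #-}
-- Run the first k steps with independent coin vectors c₁, …, cₖ, one coin per edge.
-- From {s}, the vertex t is labelled at time k iff there is a lazy walk
-- s = v₀, v₁, …, vₖ = t in which each vᵢ equals vᵢ₋₁ or is joined to it by an edge
-- whose coin in cᵢ is heads.  Reversing such a walk gives a lazy walk from t to s for
-- the reversed coin sequence cₖ, …, c₁, which has the same law.  Hence
-- P(Z_st ≤ k) = P(Z_ts ≤ k) for every k, and the point probabilities are differences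
-- of these.
module Submission where

open import Defs
open import Data.Bool using (Bool; true; false; _∨_; if_then_else_)
open import Data.Bool.Properties using (⇔→≡; ∨-zeroʳ; ∧-zeroʳ)
open import Data.Fin using (Fin; zero; suc)
open import Data.Fin.Properties using (_≟_)
open import Data.List using (List; []; _∷_; map; _++_; foldr)
open import Data.Nat using (ℕ; zero; suc)
open import Data.Product using (_×_; _,_; ∃-syntax)
open import Data.Rational using (ℚ; 0ℚ; 1ℚ; _<_; _≤_; _+_; _*_; _-_)
open import Data.Rational.Properties using (*-identityʳ; +-identityˡ; +-identityʳ; +-assoc; *-zeroʳ)
open import Data.Rational.Solver using (module +-*-Solver)
open import Data.Sum using (_⊎_; inj₁; inj₂; swap)
open import Data.Vec using (Vec; []; _∷_; lookup; reverse; _∷ʳ_)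
open import Data.Vec.Properties using (lookup∘tabulate; reverse-∷; reverse-involutive)
open import Function.Bundles using (mk⇔)
open import Relation.Nullary using (yes; no; contradiction)
open import Relation.Nullary.Decidable using (⌊_⌋)
open import Relation.Binary.PropositionalEquality
  using (_≡_; refl; sym; trans; cong; cong₂; subst; module ≡-Reasoning)

open +-*-Solver using (solve; _:+_; _:*_; _:-_; _:=_; con)

weightedSum : {A : Set} → (A → ℚ) → List A → (A → ℚ) → ℚ
weightedSum w xs f = foldr (λ x acc → w x * f x + acc) 0ℚ xs

module _ {A : Set} (w : A → ℚ) where

  weightedSum-cong : ∀ xs {f g : A → ℚ} → (∀ x → f x ≡ g x) →
    weightedSum w xs f ≡ weightedSum w xs g
  weightedSum-cong []       f≗g = refl
  weightedSum-cong (x ∷ xs) f≗g = cong₂ (λ a b → w x * a + b) (f≗g x) (weightedSum-cong xs f≗g)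

  weightedSum-zero : ∀ xs → weightedSum w xs (λ _ → 0ℚ) ≡ 0ℚ
  weightedSum-zero []       = refl
  weightedSum-zero (x ∷ xs) = cong₂ _+_ (*-zeroʳ (w x)) (weightedSum-zero xs)

  weightedSum-+ : ∀ xs (f g : A → ℚ) →
    weightedSum w xs (λ x → f x + g x) ≡ weightedSum w xs f + weightedSum w xs g
  weightedSum-+ []       f g = refl
  weightedSum-+ (x ∷ xs) f g = trans (cong (w x * (f x + g x) +_) (weightedSum-+ xs f g))
    (solve 5 (λ a b c d e → a :* (b :+ c) :+ (d :+ e) := (a :* b :+ d) :+ (a :* c :+ e))
      refl (w x) (f x) (g x) (weightedSum w xs f) (weightedSum w xs g))

  weightedSum-minus : ∀ xs (f g : A → ℚ) →
    weightedSum w xs (λ x → f x - g x) ≡ weightedSum w xs f - weightedSum w xs g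
  weightedSum-minus []       f g = refl
  weightedSum-minus (x ∷ xs) f g = trans (cong (w x * (f x - g x) +_) (weightedSum-minus xs f g))
    (solve 5 (λ a b c d e → a :* (b :- c) :+ (d :- e) := (a :* b :+ d) :- (a :* c :+ e))
      refl (w x) (f x) (g x) (weightedSum w xs f) (weightedSum w xs g))

  weightedSum-*ˡ : ∀ xs a (f : A → ℚ) → weightedSum w xs (λ x → a * f x) ≡ a * weightedSum w xs f
  weightedSum-*ˡ []       a f = sym (*-zeroʳ a)
  weightedSum-*ˡ (x ∷ xs) a f = trans (cong (w x * (a * f x) +_) (weightedSum-*ˡ xs a f))
    (solve 4 (λ u a b d → u :* (a :* b) :+ a :* d := a :* (u :* b :+ d))
      refl (w x) a (f x) (weightedSum w xs f))

  weightedSum-const : ∀ xs a → weightedSum w xs (λ _ → a) ≡ a * weightedSum w xs (λ _ → 1ℚ)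
  weightedSum-const xs a =
    trans (weightedSum-cong xs (λ _ → sym (*-identityʳ a))) (weightedSum-*ˡ xs a (λ _ → 1ℚ))

  weightedSum-++ : ∀ xs ys (f : A → ℚ) →
    weightedSum w (xs ++ ys) f ≡ weightedSum w xs f + weightedSum w ys f
  weightedSum-++ []       ys f = sym (+-identityˡ _)
  weightedSum-++ (x ∷ xs) ys f = trans (cong (w x * f x +_) (weightedSum-++ xs ys f))
    (sym (+-assoc (w x * f x) _ _))

  weightedSum-comm : ∀ xs ys (h : A → A → ℚ) →
    weightedSum w xs (λ x → weightedSum w ys (h x)) ≡ weightedSum w ys (λ y → weightedSum w xs (λ x → h x y))
  weightedSum-comm []       ys h = sym (weightedSum-zero ys)
  weightedSum-comm (x ∷ xs) ys h = begin
      w x * weightedSum w ys (h x) + weightedSum w xs (λ x′ → weightedSum w ys (h x′))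
    ≡⟨ cong₂ _+_ (sym (weightedSum-*ˡ ys (w x) (h x))) (weightedSum-comm xs ys h) ⟩
      weightedSum w ys (λ y → w x * h x y) + weightedSum w ys (λ y → weightedSum w xs (λ x′ → h x′ y))
    ≡⟨ sym (weightedSum-+ ys _ _) ⟩
      weightedSum w ys (λ y → w x * h x y + weightedSum w xs (λ x′ → h x′ y)) ∎
    where open ≡-Reasoning

weightedSum-map : ∀ {A B : Set} (w : B → ℚ) (g : A → B) xs (f : B → ℚ) →
  weightedSum w (map g xs) f ≡ weightedSum (λ x → w (g x)) xs (λ x → f (g x))
weightedSum-map w g []       f = refl
weightedSum-map w g (x ∷ xs) f = cong (w (g x) * f (g x) +_) (weightedSum-map w g xs f)

weightedSum-scaleʷ : ∀ {A : Set} (w : A → ℚ) a xs (f : A → ℚ) →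
  weightedSum (λ x → a * w x) xs f ≡ a * weightedSum w xs f
weightedSum-scaleʷ w a []       f = sym (*-zeroʳ a)
weightedSum-scaleʷ w a (x ∷ xs) f = trans (cong (a * w x * f x +_) (weightedSum-scaleʷ w a xs f))
  (solve 4 (λ a u b d → a :* u :* b :+ a :* d := a :* (u :* b :+ d))
    refl a (w x) (f x) (weightedSum w xs f))

allCoins-total : ∀ p m → weightedSum (weight p) (allCoins m) (λ _ → 1ℚ) ≡ 1ℚ
allCoins-total p zero    = refl
allCoins-total p (suc m) = begin
    weightedSum (weight p) (map (true ∷_) cs ++ map (false ∷_) cs) (λ _ → 1ℚ)
  ≡⟨ weightedSum-++ (weight p) (map (true ∷_) cs) _ _ ⟩
    weightedSum (weight p) (map (true ∷_) cs) (λ _ → 1ℚ) + weightedSum (weight p) (map (false ∷_) cs) (λ _ → 1ℚ)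
  ≡⟨ cong₂ _+_ (weightedSum-map (weight p) (true ∷_) cs _) (weightedSum-map (weight p) (false ∷_) cs _) ⟩
    weightedSum (λ c → p * weight p c) cs (λ _ → 1ℚ) + weightedSum (λ c → (1ℚ - p) * weight p c) cs (λ _ → 1ℚ)
  ≡⟨ cong₂ _+_ (weightedSum-scaleʷ (weight p) p cs _) (weightedSum-scaleʷ (weight p) (1ℚ - p) cs _) ⟩
    p * weightedSum (weight p) cs (λ _ → 1ℚ) + (1ℚ - p) * weightedSum (weight p) cs (λ _ → 1ℚ)
  ≡⟨ cong (λ r → p * r + (1ℚ - p) * r) (allCoins-total p m) ⟩
    p * 1ℚ + (1ℚ - p) * 1ℚ
  ≡⟨ solve 1 (λ p → p :* con 1ℚ :+ (con 1ℚ :- p) :* con 1ℚ := con 1ℚ) refl p ⟩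
    1ℚ ∎
  where
  open ≡-Reasoning
  cs = allCoins m

module Rounds {A : Set} (w : A → ℚ) (xs : List A) where

  𝔼 : (k : ℕ) → (Vec A k → ℚ) → ℚ
  𝔼 zero    f = f []
  𝔼 (suc k) f = weightedSum w xs (λ x → 𝔼 k (λ ys → f (x ∷ ys)))

  𝔼-cong : ∀ k {f g : Vec A k → ℚ} → (∀ ys → f ys ≡ g ys) → 𝔼 k f ≡ 𝔼 k g
  𝔼-cong zero    f≗g = f≗g []
  𝔼-cong (suc k) f≗g = weightedSum-cong w xs (λ x → 𝔼-cong k (λ ys → f≗g (x ∷ ys)))

  𝔼-const : weightedSum w xs (λ _ → 1ℚ) ≡ 1ℚ → ∀ k a → 𝔼 k (λ _ → a) ≡ a
  𝔼-const total zero    a = refl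
  𝔼-const total (suc k) a = begin
      weightedSum w xs (λ _ → 𝔼 k (λ _ → a)) ≡⟨ weightedSum-cong w xs (λ _ → 𝔼-const total k a) ⟩
      weightedSum w xs (λ _ → a)             ≡⟨ weightedSum-const w xs a ⟩
      a * weightedSum w xs (λ _ → 1ℚ)        ≡⟨ cong (a *_) total ⟩
      a * 1ℚ                                 ≡⟨ *-identityʳ a ⟩
      a                                      ∎
    where open ≡-Reasoning

  weightedSum-𝔼 : ∀ k (h : A → Vec A k → ℚ) →
    weightedSum w xs (λ x → 𝔼 k (h x)) ≡ 𝔼 k (λ ys → weightedSum w xs (λ x → h x ys))
  weightedSum-𝔼 zero    h = refl
  weightedSum-𝔼 (suc k) h = trans (weightedSum-comm w xs xs (λ x y → 𝔼 k (λ ys → h x (y ∷ ys))))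
    (weightedSum-cong w xs (λ y → weightedSum-𝔼 k (λ x ys → h x (y ∷ ys))))

  𝔼-∷ʳ : ∀ k (f : Vec A (suc k) → ℚ) → 𝔼 (suc k) f ≡ 𝔼 k (λ ys → weightedSum w xs (λ x → f (ys ∷ʳ x)))
  𝔼-∷ʳ zero    f = refl
  𝔼-∷ʳ (suc k) f = weightedSum-cong w xs (λ y → 𝔼-∷ʳ k (λ ys → f (y ∷ ys)))

  𝔼-reverse : ∀ k (f : Vec A k → ℚ) → 𝔼 k (λ ys → f (reverse ys)) ≡ 𝔼 k f
  𝔼-reverse zero    f = refl
  𝔼-reverse (suc k) f = begin
      weightedSum w xs (λ x → 𝔼 k (λ ys → f (reverse (x ∷ ys))))
    ≡⟨ weightedSum-cong w xs (λ x → 𝔼-cong k (λ ys → cong f (reverse-∷ x ys))) ⟩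
      weightedSum w xs (λ x → 𝔼 k (λ ys → f (reverse ys ∷ʳ x)))
    ≡⟨ weightedSum-cong w xs (λ x → 𝔼-reverse k (λ ys → f (ys ∷ʳ x))) ⟩
      weightedSum w xs (λ x → 𝔼 k (λ ys → f (ys ∷ʳ x)))
    ≡⟨ weightedSum-𝔼 k (λ x ys → f (ys ∷ʳ x)) ⟩
      𝔼 k (λ ys → weightedSum w xs (λ x → f (ys ∷ʳ x)))
    ≡⟨ 𝔼-∷ʳ k f ⟨
      𝔼 (suc k) f ∎
    where open ≡-Reasoning

open Rounds

module _ {N : ℕ} where

  Joins : Fin N × Fin N → Fin N → Fin N → Set
  Joins e u v = e ≡ (u , v) ⊎ e ≡ (v , u)

  OpenEdge : ∀ {k} → Vec (Fin N × Fin N) k → Vec Bool k → Fin N → Fin N → Set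
  OpenEdge es cs u v = ∃[ i ] lookup cs i ≡ true × Joins (lookup es i) u v

  OpenEdge-sym : ∀ {k} (es : Vec (Fin N × Fin N) k) cs {u v} → OpenEdge es cs u v → OpenEdge es cs v u
  OpenEdge-sym _ _ (i , heads , joins) = i , heads , swap joins

  module _ (X : Labelled N) where

    copies-true⇒ : ∀ v a b c → copies X v (a , b) c ≡ true →
      ∃[ u ] lookup X u ≡ true × c ≡ true × Joins (a , b) u v
    copies-true⇒ v a b true eq with v ≟ b | lookup X a in Xa | v ≟ a | lookup X b in Xb
    ... | yes refl | true | _ | _ = a , Xa , refl , inj₁ refl
    ... | _ | _ | yes refl | true = b , Xb , refl , inj₂ refl
    copies-true⇒ v a b true () | yes refl | false | no _     | _
    copies-true⇒ v a b true () | yes refl | false | yes refl | false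
    copies-true⇒ v a b true () | no _     | _     | no _     | _
    copies-true⇒ v a b true () | no _     | _     | yes refl | false

    copies-true⇐ : ∀ {u v} e → lookup X u ≡ true → lookup X v ≡ false → Joins e u v →
      copies X v e true ≡ true
    copies-true⇐ {v = v} _ Xu Xv (inj₁ refl) with v ≟ v
    ... | yes _  rewrite Xu | Xv = refl
    ... | no v≢v = contradiction refl v≢v
    copies-true⇐ {u} {v} _ Xu Xv (inj₂ refl) with v ≟ v
    ... | yes _  rewrite Xu | Xv | ∧-zeroʳ ⌊ v ≟ u ⌋ = refl
    ... | no v≢v = contradiction refl v≢v

    anyCopy-true⇒ : ∀ {k} v (es : Vec (Fin N × Fin N) k) cs → anyCopy X v es cs ≡ true →
      ∃[ u ] lookup X u ≡ true × OpenEdge es cs u v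
    anyCopy-true⇒ v [] [] ()
    anyCopy-true⇒ v ((a , b) ∷ es) (c ∷ cs) eq with copies X v (a , b) c in copied
    ... | true  = let u , Xu , heads , joins = copies-true⇒ v a b c copied in u , Xu , zero , heads , joins
    ... | false = let u , Xu , i , heads , joins = anyCopy-true⇒ v es cs eq in u , Xu , suc i , heads , joins

    anyCopy-true⇐ : ∀ {k u v} (es : Vec (Fin N × Fin N) k) cs →
      lookup X u ≡ true → lookup X v ≡ false → OpenEdge es cs u v → anyCopy X v es cs ≡ true
    anyCopy-true⇐ (e ∷ es) (.true ∷ cs) Xu Xv (zero , refl , joins)
      rewrite copies-true⇐ e Xu Xv joins = refl
    anyCopy-true⇐ (e ∷ es) (c ∷ cs) Xu Xv (suc i , heads , joins)
      rewrite anyCopy-true⇐ es cs Xu Xv (i , heads , joins) = ∨-zeroʳ _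

module Spread (G : Graph) where

  Coins : Set
  Coins = Vec Bool (m G)

  Hop : Coins → Fin (n G) → Fin (n G) → Set
  Hop c u v = u ≡ v ⊎ OpenEdge (edges G) c u v

  Hop-sym : ∀ c {u v} → Hop c u v → Hop c v u
  Hop-sym c (inj₁ u≡v)    = inj₁ (sym u≡v)
  Hop-sym c (inj₂ opened) = inj₂ (OpenEdge-sym (edges G) c opened)

  lookup-step : ∀ X c v → lookup (step G X c) v ≡ lookup X v ∨ anyCopy X v (edges G) c
  lookup-step X c v = lookup∘tabulate (λ v → lookup X v ∨ anyCopy X v (edges G) c) v

  step-true⇒ : ∀ X c v → lookup (step G X c) v ≡ true → ∃[ u ] lookup X u ≡ true × Hop c u v
  step-true⇒ X c v eq with lookup X v in Xv | trans (sym (lookup-step X c v)) eq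
  ... | true  | _      = v , Xv , inj₁ refl
  ... | false | copied = let u , Xu , opened = anyCopy-true⇒ X v (edges G) c copied in u , Xu , inj₂ opened

  step-true⇐ : ∀ X c {u v} → lookup X u ≡ true → Hop c u v → lookup (step G X c) v ≡ true
  step-true⇐ X c {u} Xu (inj₁ refl) rewrite lookup-step X c u | Xu = refl
  step-true⇐ X c {u} {v} Xu (inj₂ opened) rewrite lookup-step X c v with lookup X v in Xv
  ... | true  = refl
  ... | false = anyCopy-true⇐ X (edges G) c Xu Xv opened

  run : ∀ {k} → Labelled (n G) → Vec Coins k → Labelled (n G)
  run X []       = X
  run X (c ∷ cs) = run (step G X c) cs

  data Walk : ∀ {k} → Vec Coins k → Fin (n G) → Fin (n G) → Set where
    []  : ∀ {u} → Walk [] u u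
    _∷_ : ∀ {k c u v w} {cs : Vec Coins k} → Hop c u v → Walk cs v w → Walk (c ∷ cs) u w

  stay : ∀ {k} (cs : Vec Coins k) {u} → Walk cs u u
  stay []       = []
  stay (c ∷ cs) = inj₁ refl ∷ stay cs

  Walk-∷ʳ : ∀ {k c u v w} {cs : Vec Coins k} → Walk cs u v → Hop c v w → Walk (cs ∷ʳ c) u w
  Walk-∷ʳ []       hop = hop ∷ []
  Walk-∷ʳ (h ∷ hs) hop = h ∷ Walk-∷ʳ hs hop

  Walk-reverse : ∀ {k u w} {cs : Vec Coins k} → Walk cs u w → Walk (reverse cs) w u
  Walk-reverse [] = []
  Walk-reverse {u = u} {w} (_∷_ {c = c} {cs = cs} h hs) =
    subst (λ ds → Walk ds w u) (sym (reverse-∷ c cs)) (Walk-∷ʳ (Walk-reverse hs) (Hop-sym c h))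

  run-true⇒ : ∀ {k} X (cs : Vec Coins k) w → lookup (run X cs) w ≡ true →
    ∃[ u ] lookup X u ≡ true × Walk cs u w
  run-true⇒ X []       w Xw = w , Xw , []
  run-true⇒ X (c ∷ cs) w eq =
    let v , Yv , hs = run-true⇒ (step G X c) cs w eq
        u , Xu , h  = step-true⇒ X c v Yv
    in u , Xu , h ∷ hs

  run-true⇐ : ∀ {k} X {cs : Vec Coins k} {u w} → lookup X u ≡ true → Walk cs u w →
    lookup (run X cs) w ≡ true
  run-true⇐ X Xu []       = Xu
  run-true⇐ X Xu (h ∷ hs) = run-true⇐ (step G X _) (step-true⇐ X _ Xu h) hs

  lookup-singleton-true⇒ : ∀ s v → lookup (singleton {n G} s) v ≡ true → v ≡ s
  lookup-singleton-true⇒ s v eq rewrite lookup∘tabulate (λ v → ⌊ v ≟ s ⌋) v with v ≟ s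
  ... | yes v≡s = v≡s

  lookup-singleton-self : ∀ s → lookup (singleton {n G} s) s ≡ true
  lookup-singleton-self s rewrite lookup∘tabulate (λ v → ⌊ v ≟ s ⌋) s with s ≟ s
  ... | yes _  = refl
  ... | no s≢s = contradiction refl s≢s

  reaches : ∀ {k} → Fin (n G) → Fin (n G) → Vec Coins k → Bool
  reaches s t cs = lookup (run (singleton s) cs) t

  reaches-true⇒ : ∀ {k} s t (cs : Vec Coins k) → reaches s t cs ≡ true → Walk cs s t
  reaches-true⇒ s t cs eq with run-true⇒ (singleton s) cs t eq
  ... | v , Sv , hs rewrite lookup-singleton-true⇒ s v Sv = hs

  reaches-true⇐ : ∀ {k} {s t} {cs : Vec Coins k} → Walk cs s t → reaches s t cs ≡ true
  reaches-true⇐ {s = s} = run-true⇐ (singleton s) (lookup-singleton-self s)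

  reaches-reverse : ∀ {k} s t (cs : Vec Coins k) → reaches s t cs ≡ reaches t s (reverse cs)
  reaches-reverse s t cs = ⇔→≡ (mk⇔
    (λ eq → reaches-true⇐ (Walk-reverse (reaches-true⇒ s t cs eq)))
    (λ eq → reaches-true⇐ (subst (λ ds → Walk ds s t) (reverse-involutive cs)
                             (Walk-reverse (reaches-true⇒ t s (reverse cs) eq)))))

  run-mono : ∀ {k} X (cs : Vec Coins k) {v} → lookup X v ≡ true → lookup (run X cs) v ≡ true
  run-mono X cs Xv = run-true⇐ X Xv (stay cs)

open Spread using (run; reaches; reaches-reverse; run-mono)

𝟙 : Bool → ℚ
𝟙 b = if b then 1ℚ else 0ℚ

probWithin : (G : Graph) → ℚ → Fin (n G) → ℕ → Labelled (n G) → ℚ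
probWithin G p t k X = 𝔼 (weight p) (allCoins (m G)) k (λ cs → 𝟙 (lookup (run G X cs) t))

module _ (G : Graph) (p : ℚ) (t : Fin (n G)) where

  probWithin-labelled : ∀ k X → lookup X t ≡ true → probWithin G p t k X ≡ 1ℚ
  probWithin-labelled k X Xt = trans
    (𝔼-cong (weight p) (allCoins (m G)) k (λ cs → cong 𝟙 (run-mono G X cs Xt)))
    (𝔼-const (weight p) (allCoins (m G)) (allCoins-total p (m G)) k 1ℚ)

  probFirst-suc : ∀ k X →
    probFirst G p t (suc k) X ≡ probWithin G p t (suc k) X - probWithin G p t k X
  probFirst-suc k X with lookup X t in Xt
  ... | true rewrite probWithin-labelled (suc k) X Xt | probWithin-labelled k X Xt = refl
  probFirst-suc zero X | false rewrite Xt = sym (+-identityʳ _)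
  probFirst-suc (suc k) X | false = trans
    (weightedSum-cong (weight p) (allCoins (m G)) (λ c → probFirst-suc k (step G X c)))
    (weightedSum-minus (weight p) (allCoins (m G)) _ _)

probWithin-singleton-comm : ∀ G p s t k →
  probWithin G p t k (singleton s) ≡ probWithin G p s k (singleton t)
probWithin-singleton-comm G p s t k = trans
  (𝔼-cong (weight p) (allCoins (m G)) k (λ cs → cong 𝟙 (reaches-reverse G s t cs)))
  (𝔼-reverse (weight p) (allCoins (m G)) k (λ cs → 𝟙 (reaches G t s cs)))

mainTheorem2 : (G : Graph) → Loopless G → (p : ℚ) → 0ℚ < p → p ≤ 1ℚ →
    (s t : Fin (n G)) → (k : ℕ) → probZ G p s t k ≡ probZ G p t s k
mainTheorem2 G _ p _ _ s t zero    = probWithin-singleton-comm G p s t zero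
mainTheorem2 G _ p _ _ s t (suc k) = begin
    probZ G p s t (suc k)
  ≡⟨ probFirst-suc G p t k (singleton s) ⟩
    probWithin G p t (suc k) (singleton s) - probWithin G p t k (singleton s)
  ≡⟨ cong₂ _-_ (probWithin-singleton-comm G p s t (suc k)) (probWithin-singleton-comm G p s t k) ⟩
    probWithin G p s (suc k) (singleton t) - probWithin G p s k (singleton t)
  ≡⟨ probFirst-suc G p s k (singleton t) ⟨
    probZ G p t s (suc k) ∎
  where open ≡-Reasoning
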